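{- Let $r\ge1$ be an integer. If $B\subset\mathcal{S}_n$ is $(r,r)$-guaranteed, then $B$ is $(r+2,r+2)$-guaranteed.
   Context: $\Sigma$ is a finite alphabet with $|\Sigma|>1$, $n\ge1$, $\mathcal{S}_n=\Sigma^n$ with the edit (Levenshtein) distance $\mathrm{edit}$. $N_n^r(s)=\{t\in\mathcal{S}_n:\mathrm{edit}(s,t)\le r\}$. A subset $B\subset\mathcal{S}_n$ is $(d_1,r)$-guaranteed if $N_n^r(s)\cap N_n^r(t)\cap B\neq\emptyset$ for every pair $s,t\in\mathcal{S}_n$ with $\mathrm{edit}(s,t)\le d_1$. -}

module Defs where

open import Data.Nat using (ℕ; zero; suc; _+_; _≤_; _⊓_)
open import Data.Fin using (Fin)
open import Data.Fin.Properties using (_≟_)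
open import Data.List using (List; []; _∷_; length)
open import Data.Vec using (Vec; toList)
open import Data.Product using (_×_; ∃)
open import Relation.Nullary using (yes; no)

subCost : ∀ {k} → Fin k → Fin k → ℕ
subCost x y with x ≟ y
... | yes _ = 0
... | no _  = 1

lev : ∀ {k} → List (Fin k) → List (Fin k) → ℕ
lev [] ys = length ys
lev (x ∷ xs) [] = suc (length xs)
lev (x ∷ xs) (y ∷ ys) =
  suc (lev xs (y ∷ ys)) ⊓ (suc (lev (x ∷ xs) ys) ⊓ (lev xs ys + subCost x y))

S : ℕ → ℕ → Set
S k n = Vec (Fin k) n

edit : ∀ {k n} → S k n → S k n → ℕ
edit s t = lev (toList s) (toList t)

InBall : ∀ {k n} → ℕ → S k n → S k n → Set
InBall r s u = edit s u ≤ r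

Guaranteed : ∀ {k n} → (S k n → Set) → ℕ → ℕ → Set
Guaranteed {k} {n} B d₁ r =
  (s t : S k n) → edit s t ≤ d₁ →
  ∃ λ u → InBall r s u × InBall r t u × B u

-- If edit(s, t) ≤ r + 2, an optimal alignment of s and t can be shortened by one
-- unit of cost at the price of moving s to a word v of the same length with
-- edit(s, v) ≤ 2 (an unmatched deletion is paired with the next insertion, or a
-- mismatch is repaired). Doing this once from s and once from t produces words
-- v₁, v₂ ∈ S_n with edit(v₁, v₂) ≤ r; a common r-neighbour of them in B is then
-- within r + 2 of both s and t by the triangle inequality.
module Submission where

open import Defs
open import Data.Nat using (ℕ; suc; _+_; _⊓_; _≤_; _<_; _≤?_; z≤n; s≤s)
open import Data.Nat.Properties
  using ( ≤-refl; ≤-reflexive; ≤-trans; ≤-pred; n≤1+n; m≤n⇒m≤1+n; m≤m+n; m≤n+m; ≰⇒>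
        ; +-identityʳ; +-comm; +-suc; +-mono-≤; +-monoˡ-≤; +-monoʳ-≤
        ; ⊓-sel; m⊓n≤m; m⊓n≤n; suc-injective; n≤0⇒n≡0; +-commutativeSemigroup )
open import Algebra.Properties.CommutativeSemigroup +-commutativeSemigroup using (interchange)
open import Data.Fin using (Fin)
open import Data.Fin.Properties using (_≟_)
open import Data.List using (List; []; _∷_; length)
open import Data.Vec using (toList; fromList; cast)
open import Data.Vec.Properties using (length-toList; toList-cast; toList∘fromList)
open import Data.Product using (_×_; _,_; ∃; Σ)
open import Data.Sum using (_⊎_; inj₁; inj₂)
open import Relation.Nullary using (yes; no; ¬_)
open import Relation.Binary.PropositionalEquality
  using (_≡_; refl; sym; trans; cong; subst)

Word : ℕ → Set
Word k = List (Fin k)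

module _ {k : ℕ} where

  subCost-cases : (x y : Fin k) → (x ≡ y × subCost x y ≡ 0) ⊎ (¬ x ≡ y × subCost x y ≡ 1)
  subCost-cases x y with x ≟ y
  ... | yes x≡y = inj₁ (x≡y , refl)
  ... | no x≢y  = inj₂ (x≢y , refl)

  subCost-refl : (x : Fin k) → subCost x x ≡ 0
  subCost-refl x with subCost-cases x x
  ... | inj₁ (_ , c≡0) = c≡0
  ... | inj₂ (x≢x , _) with () ← x≢x refl

  subCost≤1 : (x y : Fin k) → subCost x y ≤ 1
  subCost≤1 x y with subCost-cases x y
  ... | inj₁ (_ , c≡0) = ≤-trans (≤-reflexive c≡0) z≤n
  ... | inj₂ (_ , c≡1) = ≤-reflexive c≡1

  subCost-sym : (x y : Fin k) → subCost x y ≡ subCost y x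
  subCost-sym x y with subCost-cases x y
  ... | inj₁ (refl , _) = refl
  ... | inj₂ (x≢y , c≡1) with subCost-cases y x
  ...   | inj₁ (y≡x , _)  with () ← x≢y (sym y≡x)
  ...   | inj₂ (_ , c′≡1) = trans c≡1 (sym c′≡1)

  subCost-triangle : (x y z : Fin k) → subCost x z ≤ subCost x y + subCost y z
  subCost-triangle x y z with subCost-cases x y | subCost-cases y z
  ... | inj₁ (refl , _) | inj₁ (refl , _) = ≤-reflexive (sym (cong (_+ subCost x x) (subCost-refl x)))
  ... | _ | inj₂ (_ , c≡1) = ≤-trans (subCost≤1 x z) (≤-trans (≤-reflexive (sym c≡1)) (m≤n+m _ _))
  ... | inj₂ (_ , c≡1) | _ = ≤-trans (subCost≤1 x z) (≤-trans (≤-reflexive (sym c≡1)) (m≤m+n _ _))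

  data Alignment : Word k → Word k → ℕ → Set where
    done : Alignment [] [] 0
    del  : ∀ {xs ys c} x → Alignment xs ys c → Alignment (x ∷ xs) ys (suc c)
    ins  : ∀ {xs ys c} y → Alignment xs ys c → Alignment xs (y ∷ ys) (suc c)
    sub  : ∀ {xs ys c} x y → Alignment xs ys c → Alignment (x ∷ xs) (y ∷ ys) (c + subCost x y)

  recost : ∀ {xs ys c d} → c ≡ d → Alignment xs ys c → Alignment xs ys d
  recost refl α = α

  keep : ∀ {xs ys c} x → Alignment xs ys c → Alignment (x ∷ xs) (x ∷ ys) c
  keep {c = c} x α = recost (trans (cong (c +_) (subCost-refl x)) (+-identityʳ c)) (sub x x α)

  alignment-refl : ∀ xs → Alignment xs xs 0
  alignment-refl []       = done
  alignment-refl (x ∷ xs) = keep x (alignment-refl xs)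

  alignment-sym : ∀ {xs ys c} → Alignment xs ys c → Alignment ys xs c
  alignment-sym done        = done
  alignment-sym (del x α)   = ins x (alignment-sym α)
  alignment-sym (ins y α)   = del y (alignment-sym α)
  alignment-sym (sub {c = c} x y α) = recost (cong (c +_) (subCost-sym y x)) (sub y x (alignment-sym α))

  alignment-trans : ∀ {xs ys zs a b} → Alignment xs ys a → Alignment ys zs b →
                    ∃ λ c → Alignment xs zs c × c ≤ a + b
  alignment-trans {a = a} α (ins {c = b} z β) with alignment-trans α β
  ... | c , γ , c≤ = suc c , ins z γ , ≤-trans (s≤s c≤) (≤-reflexive (sym (+-suc a b)))
  alignment-trans (del x α) β with alignment-trans α β
  ... | c , γ , c≤ = suc c , del x γ , s≤s c≤
  alignment-trans done done = 0 , done , z≤n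
  alignment-trans (ins {c = a} y α) (del {c = b} y β) with alignment-trans α β
  ... | c , γ , c≤ = c , γ , ≤-trans c≤ (≤-trans (+-monoʳ-≤ a (n≤1+n b)) (n≤1+n _))
  alignment-trans (ins {c = a} y α) (sub {c = b} y z β) with alignment-trans α β
  ... | c , γ , c≤ = suc c , ins z γ , s≤s (≤-trans c≤ (+-monoʳ-≤ a (m≤m+n b _)))
  alignment-trans (sub {c = a} x y α) (del {c = b} y β) with alignment-trans α β
  ... | c , γ , c≤ = suc c , del x γ ,
        ≤-trans (s≤s (≤-trans c≤ (+-monoˡ-≤ b (m≤m+n a _)))) (≤-reflexive (sym (+-suc _ b)))
  alignment-trans (sub {c = a} x y α) (sub {c = b} y z β) with alignment-trans α β
  ... | c , γ , c≤ = c + subCost x z , sub x z γ ,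
        ≤-trans (+-mono-≤ c≤ (subCost-triangle x y z))
                (≤-reflexive (interchange a b (subCost x y) (subCost y z)))

  lev-alignment : ∀ xs ys → Alignment xs ys (lev xs ys)
  lev-alignment [] []             = done
  lev-alignment [] (y ∷ ys)       = ins y (lev-alignment [] ys)
  lev-alignment (x ∷ [])     []   = del x done
  lev-alignment (x ∷ x′ ∷ xs) []   = del x (lev-alignment (x′ ∷ xs) [])
  lev-alignment (x ∷ xs) (y ∷ ys) =
    cheapest (del x (lev-alignment xs (y ∷ ys)))
             (ins y (lev-alignment (x ∷ xs) ys))
             (sub x y (lev-alignment xs ys))
    where
    cheapest : ∀ {xs ys a b c} → Alignment xs ys a → Alignment xs ys b → Alignment xs ys c →
               Alignment xs ys (a ⊓ (b ⊓ c))
    cheapest {a = a} {b} {c} α β γ with ⊓-sel a (b ⊓ c) | ⊓-sel b c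
    ... | inj₁ m≡a | _        = recost (sym m≡a) α
    ... | inj₂ m≡n | inj₁ n≡b = recost (sym (trans m≡n n≡b)) β
    ... | inj₂ m≡n | inj₂ n≡c = recost (sym (trans m≡n n≡c)) γ

  lev-minimal : ∀ {xs ys c} → Alignment xs ys c → lev xs ys ≤ c
  lev-minimal done = z≤n
  lev-minimal {_ ∷ []}    {[]} (del x α) = s≤s (lev-minimal α)
  lev-minimal {_ ∷ _ ∷ _} {[]} (del x α) = s≤s (lev-minimal α)
  lev-minimal {_ ∷ _} {_ ∷ _}  (del x α) = ≤-trans (m⊓n≤m _ _) (s≤s (lev-minimal α))
  lev-minimal {[]} (ins y α) = s≤s (lev-minimal α)
  lev-minimal {_ ∷ _} (ins y α) = ≤-trans (m⊓n≤n _ _) (≤-trans (m⊓n≤m _ _) (s≤s (lev-minimal α)))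
  lev-minimal (sub x y α) = ≤-trans (m⊓n≤n _ _) (≤-trans (m⊓n≤n _ _) (+-monoˡ-≤ _ (lev-minimal α)))

  lev-refl : ∀ xs → lev xs xs ≡ 0
  lev-refl xs = n≤0⇒n≡0 (lev-minimal (alignment-refl xs))

  lev-sym : ∀ xs ys → lev ys xs ≤ lev xs ys
  lev-sym xs ys = lev-minimal (alignment-sym (lev-alignment xs ys))

  lev-triangle : ∀ xs ys zs → lev xs zs ≤ lev xs ys + lev ys zs
  lev-triangle xs ys zs with alignment-trans (lev-alignment xs ys) (lev-alignment ys zs)
  ... | c , γ , c≤ = ≤-trans (lev-minimal γ) c≤

  record Detour (P : Word k → Set) (a : ℕ) (xs ys : Word k) (c : ℕ) : Set where
    constructor detour
    field
      {via} : Word k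
      {cost₁ cost₂} : ℕ
      via-ok  : P via
      first   : Alignment xs via cost₁
      second  : Alignment via ys cost₂
      cheap   : cost₁ ≤ a
      shorter : suc cost₂ ≤ c

  insert-first : ∀ {xs ys c} → Alignment xs ys c → length xs < length ys →
                 Detour (λ w → length w ≡ suc (length xs)) 1 xs ys c
  insert-first {xs} (ins y α) _ = detour refl (ins y (alignment-refl xs)) (keep y α) ≤-refl ≤-refl
  insert-first (del x α) lt with insert-first α (≤-trans (n≤1+n _) lt)
  ... | detour len α₁ α₂ le₁ le₂ = detour (cong suc len) (keep x α₁) (del x α₂) le₁ (s≤s le₂)
  insert-first (sub x y α) lt with insert-first α (≤-pred lt)
  ... | detour len α₁ α₂ le₁ le₂ = detour (cong suc len) (keep x α₁) (sub x y α₂) le₁ (+-monoˡ-≤ _ le₂)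

  delete-first : ∀ {xs ys c} → Alignment xs ys c → length ys < length xs →
                 Detour (λ w → suc (length w) ≡ length xs) 1 xs ys c
  delete-first (del {xs = xs} x α) _ = detour refl (del x (alignment-refl xs)) α ≤-refl ≤-refl
  delete-first (ins y α) lt with delete-first α (≤-trans (n≤1+n _) lt)
  ... | detour len α₁ α₂ le₁ le₂ = detour len α₁ (ins y α₂) le₁ (s≤s le₂)
  delete-first (sub x y α) lt with delete-first α (≤-pred lt)
  ... | detour len α₁ α₂ le₁ le₂ = detour (cong suc len) (keep x α₁) (sub x y α₂) le₁ (+-monoˡ-≤ _ le₂)

  -- The first non-free operation is a mismatch, which is repaired, or an
  -- insertion/deletion, whose length change is undone by the next one of the
  -- opposite kind (it exists because the lengths agree).
  sameLength-detour : ∀ {xs ys c} → Alignment xs ys c → length xs ≡ length ys → 1 ≤ c →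
                      Detour (λ w → length w ≡ length xs) 2 xs ys c
  sameLength-detour (del x α) eq _ with insert-first α (≤-reflexive eq)
  ... | detour len α₁ α₂ le₁ le₂ = detour len (del x α₁) α₂ (s≤s le₁) (m≤n⇒m≤1+n le₂)
  sameLength-detour (ins y α) eq _ with delete-first α (≤-reflexive (sym eq))
  ... | detour len α₁ α₂ le₁ le₂ = detour len (ins y α₁) (keep y α₂) (s≤s le₁) (m≤n⇒m≤1+n le₂)
  sameLength-detour {x ∷ xs} (sub {c = c} x y α) eq pos with subCost-cases x y
  ... | inj₂ (_ , c≡1) =
    detour refl (sub x y (alignment-refl xs)) (keep y α) (≤-trans (subCost≤1 x y) (n≤1+n 1))
           (≤-reflexive (trans (+-comm 1 c) (cong (c +_) (sym c≡1))))
  ... | inj₁ (refl , c≡0) = keep-both (sameLength-detour α (suc-injective eq) (subst (1 ≤_) cost≡ pos))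
    where
    cost≡ : c + subCost x x ≡ c
    cost≡ = trans (cong (c +_) c≡0) (+-identityʳ c)
    keep-both : ∀ {ys} → Detour (λ w → length w ≡ length xs) 2 xs ys c →
                Detour (λ w → length w ≡ suc (length xs)) 2 (x ∷ xs) (x ∷ ys) (c + subCost x x)
    keep-both (detour len α₁ α₂ le₁ le₂) =
      detour (cong suc len) (keep x α₁) (keep x α₂) le₁ (subst (_ ≤_) (sym cost≡) le₂)

module _ {k n : ℕ} where

  fromWord : (w : Word k) → length w ≡ n → Σ (S k n) (λ v → toList v ≡ w)
  fromWord w eq = cast eq (fromList w) , trans (toList-cast eq (fromList w)) (toList∘fromList w)

  edit-sym : (s t : S k n) → edit t s ≤ edit s t
  edit-sym s t = lev-sym (toList s) (toList t)

  edit-triangle : (s t u : S k n) → edit s u ≤ edit s t + edit t u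
  edit-triangle s t u = lev-triangle (toList s) (toList t) (toList u)

  edit-step : (s t : S k n) {d : ℕ} → edit s t ≤ suc d → ∃ λ v → edit s v ≤ 2 × edit v t ≤ d
  edit-step s t st≤ with 1 ≤? edit s t
  ... | no ¬pos = s , ≤-trans (≤-reflexive (lev-refl (toList s))) z≤n , ≤-trans (≤-pred (≰⇒> ¬pos)) z≤n
  ... | yes pos with sameLength-detour (lev-alignment (toList s) (toList t))
                                       (trans (length-toList s) (sym (length-toList t))) pos
  ...   | detour {w} len α₁ α₂ le₁ le₂ with fromWord w (trans len (length-toList s))
  ...     | v , refl = v , ≤-trans (lev-minimal α₁) le₁ ,
                       ≤-pred (≤-trans (s≤s (lev-minimal α₂)) (≤-trans le₂ st≤))

lemma7 : (k n r : ℕ) → 2 ≤ k → 1 ≤ n → 1 ≤ r → (B : S k n → Set) →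
    Guaranteed B r r → Guaranteed B (r + 2) (r + 2)
lemma7 k n r _ _ _ B guaranteed s t st≤ with edit-step s t (subst (edit s t ≤_) (+-comm r 2) st≤)
... | v₁ , sv₁ , v₁t with edit-step t v₁ (≤-trans (edit-sym v₁ t) v₁t)
... | v₂ , tv₂ , v₂v₁ with guaranteed v₁ v₂ (≤-trans (edit-sym v₂ v₁) v₂v₁)
... | u , v₁u , v₂u , u∈B = u , through s v₁ sv₁ v₁u , through t v₂ tv₂ v₂u , u∈B
  where
  through : (x v : S k n) → edit x v ≤ 2 → edit v u ≤ r → edit x u ≤ r + 2
  through x v xv vu =
    ≤-trans (edit-triangle x v u) (≤-trans (+-mono-≤ xv vu) (≤-reflexive (+-comm 2 r)))
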